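{- Let $A$ and $B$ be time series, let $d_{A,B}$ be a dissimilarity function with nonnegative integer values, let $c=\max_{i,j}d_{A,B}(i,j)$, and let $R_{A,B}$, $S_{A,B}$, $G^\vdash_{A,B}$, $G^\dashv_{A,B}$, $H^\vdash_{A,B}$, $H^\dashv_{A,B}$ be as defined in the context. For any indices $1\le i_\vdash\le i_\dashv\le|A|$ and $1\le j_\vdash\le j_\dashv\le|B|$, the $[r(1,j_\vdash):r(|A|,j_\dashv)]$-banded HIS weight of $R_{A,B}[f(i_\vdash,1):f(i_\dashv,|B|)]$ equals the $[H^\vdash_{A,B}[j_\vdash]:H^\dashv_{A,B}[j_\dashv]]$-banded LIS length of $S_{A,B}[G^\vdash_{A,B}[i_\vdash]:G^\dashv_{A,B}[i_\dashv]]$.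
   Context: Sequences are 1-indexed; for a sequence $S$, $|S|$ is its length, $S[i]$ its $i$-th element, $S[a:b]=S[a]\circ\cdots\circ S[b]$, $\circ$ is concatenation. A subsequence of $S$ is $S[i_1]\circ\cdots\circ S[i_\ell]$ with $\ell\ge1$ and $i_1<\cdots<i_\ell$. A time series is a nonempty finite sequence; for time series $A,B$, $d_{A,B}(i,j)$ ($1\le i\le|A|$, $1\le j\le|B|$) is a nonnegative integer. For a sequence $S$ of integers: a subsequence is increasing if each element other than the last is less than the next one; it is $[h_\vdash:h_\dashv]$-banded if all its elements lie in $[h_\vdash,h_\dashv]$. The $[h_\vdash:h_\dashv]$-banded LIS length of $S$ is the maximum length of an $[h_\vdash:h_\dashv]$-banded increasing subsequence of $S$. If each element $s$ has a nonnegative weight $w(s)$, the $[h_\vdash:h_\dashv]$-banded HIS weight of $S$ is the maximum of $\sum_{s\in T}w(s)$ over all $[h_\vdash:h_\dashv]$-banded increasing subsequences $T$ of $S$. The sequence $R_{A,B}$ has length $|A||B|+(|A|-1)(|B|-1)$ and consists of distinct weighted integers. For $1\le i\le|A|$, $1\le j\le|B|$: $r(i,j)=(j-1)(2|A|-1)+i$, occurring at position $f(i,j)=f(r(i,j))=(i-1)(2|B|-1)+j$ of $R_{A,B}$, with weight $w(r(i,j))=c-d_{A,B}(i,j)$. For $2\le i\le|A|$, $2\le j\le|B|$: $\tilde r(i,j)=(j-1)(2|A|-1)-i+2$, occurring at position $f(\tilde r(i,j))=(i-1)(2|B|-1)-j+2$, with weight $w(\tilde r(i,j))=c$. These positions are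 exactly $1,\dots,|R_{A,B}|$; $f(q)$ denotes the position of element $q$. For each element $q$ of $R_{A,B}$: $g_\dashv(q)=\sum w(q')$ over elements $q'$ of $R_{A,B}$ with $f(q')\le f(q)$; $h_\dashv(q)=\sum w(q')$ over elements $q'$ of $R_{A,B}$ with $q'\le q$ (as integers); $g_\vdash(q)=g_\dashv(q)-w(q)+1$; $h_\vdash(q)=h_\dashv(q)-w(q)+1$; $S_q$ is the sequence $h_\vdash(q)\circ(h_\vdash(q)+1)\circ\cdots\circ h_\dashv(q)$ of $w(q)$ consecutive integers. The sequence $S_{A,B}=S_{R_{A,B}[1]}\circ S_{R_{A,B}[2]}\circ\cdots\circ S_{R_{A,B}[|R_{A,B}|]}$. Arrays: $G^\vdash_{A,B}[i]=g_\vdash(r(i,1))$, $G^\dashv_{A,B}[i]=g_\dashv(r(i,|B|))$ for $1\le i\le|A|$; $H^\vdash_{A,B}[j]=h_\vdash(r(1,j))$, $H^\dashv_{A,B}[j]=h_\dashv(r(|A|,j))$ for $1\le j\le|B|$. -}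

module Defs where

open import Data.Nat using (ℕ; zero; suc; _+_; _*_; _∸_; _≤_; _<_; _⊔_; _≤?_)
open import Data.List using (List; []; _∷_; _++_; map; concatMap; foldr; length; take; drop; upTo; filter)
open import Data.Nat.ListAction using (sum)
open import Relation.Binary.PropositionalEquality using (_≡_)
open import Data.Product using (_×_; _,_; proj₁; proj₂; ∃)
open import Data.List.Relation.Binary.Sublist.Propositional using (_⊆_)
open import Data.List.Relation.Unary.Linked using (Linked)
open import Data.List.Relation.Unary.All using (All)

range : ℕ → List ℕ
range k = map suc (upTo k)

-- S[a:b] = S[a] ∘ ⋯ ∘ S[b]  (1-indexed, inclusive; empty if b < a)
slice : {X : Set} → ℕ → ℕ → List X → List X
slice a b xs = take (suc b ∸ a) (drop (a ∸ 1) xs)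

IsMax : (ℕ → Set) → ℕ → Set
IsMax P k = P k × (∀ k' → P k' → k' ≤ k)

-- there is an [lo:hi]-banded increasing subsequence of xs of length k
-- (the empty subsequence is allowed, so the maximum is 0 when no element is banded)
BandedIncLen : ℕ → ℕ → List ℕ → ℕ → Set
BandedIncLen lo hi xs k =
  ∃ λ (ys : List ℕ) → ys ⊆ xs × Linked _<_ ys
    × All (λ y → lo ≤ y × y ≤ hi) ys × length ys ≡ k

BandedLIS : ℕ → ℕ → List ℕ → ℕ → Set
BandedLIS lo hi xs = IsMax (BandedIncLen lo hi xs)

-- weighted elements: (integer value , weight)
Elem : Set
Elem = ℕ × ℕ

BandedIncWeight : ℕ → ℕ → List Elem → ℕ → Set
BandedIncWeight lo hi xs k =
  ∃ λ (ys : List Elem) → ys ⊆ xs × Linked (λ a b → proj₁ a < proj₁ b) ys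
    × All (λ e → lo ≤ proj₁ e × proj₁ e ≤ hi) ys × sum (map proj₂ ys) ≡ k

BandedHIS : ℕ → ℕ → List Elem → ℕ → Set
BandedHIS lo hi xs = IsMax (BandedIncWeight lo hi xs)

-- The construction.  n = |A|, m = |B|, d i j = d_{A,B}(i,j) (1-indexed;
-- values outside 1 ≤ i ≤ n, 1 ≤ j ≤ m are never used).

dmax : ℕ → ℕ → (ℕ → ℕ → ℕ) → ℕ
dmax n m d = foldr _⊔_ 0 (concatMap (λ i → map (d i) (range m)) (range n))

rI : ℕ → ℕ → ℕ → ℕ
rI n i j = (j ∸ 1) * (2 * n ∸ 1) + i

rT : ℕ → ℕ → ℕ → ℕ
rT n i j = ((j ∸ 1) * (2 * n ∸ 1) + 2) ∸ i

fI : ℕ → ℕ → ℕ → ℕ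
fI m i j = (i ∸ 1) * (2 * m ∸ 1) + j

-- positions (i-1)(2m-1)+1 … (i-1)(2m-1)+m : r(i,1), …, r(i,m)  (weights c - d(i,j))
rPart : ℕ → ℕ → (ℕ → ℕ → ℕ) → ℕ → List Elem
rPart n m d i = map (λ j → rI n i j , dmax n m d ∸ d i j) (range m)

-- for i ≥ 2, positions (i-1)(2m-1)-m+2 … (i-1)(2m-1) : r~(i,m), r~(i,m-1), …, r~(i,2)
-- (position of r~(i,j) is (i-1)(2m-1)-j+2; weight c)
tPart : ℕ → ℕ → (ℕ → ℕ → ℕ) → ℕ → List Elem
tPart n m d zero = []
tPart n m d (suc zero) = []
tPart n m d (suc (suc i')) =
  map (λ k → rT n (suc (suc i')) (m ∸ k) , dmax n m d) (upTo (m ∸ 1))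

-- R_{A,B}: the block of row i occupies positions (i-2)(2m-1)+m+1 … (i-1)(2m-1)+m
RAB : ℕ → ℕ → (ℕ → ℕ → ℕ) → List Elem
RAB n m d = concatMap (λ i → tPart n m d i ++ rPart n m d i) (range n)

wr : ℕ → ℕ → (ℕ → ℕ → ℕ) → ℕ → ℕ → ℕ
wr n m d i j = dmax n m d ∸ d i j

gPos : ℕ → ℕ → (ℕ → ℕ → ℕ) → ℕ → ℕ
gPos n m d p = sum (map proj₂ (take p (RAB n m d)))

hle : ℕ → ℕ → (ℕ → ℕ → ℕ) → ℕ → ℕ
hle n m d q = sum (map proj₂ (filter (λ e → proj₁ e ≤? q) (RAB n m d)))

Sq : ℕ → ℕ → (ℕ → ℕ → ℕ) → Elem → List ℕ
Sq n m d (q , w) = map (λ k → (hle n m d q ∸ w + 1) + k) (upTo w)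

SAB : ℕ → ℕ → (ℕ → ℕ → ℕ) → List ℕ
SAB n m d = concatMap (Sq n m d) (RAB n m d)

-- G^⊢[i] = g_⊢(r(i,1)),  G^⊣[i] = g_⊣(r(i,|B|))
Gl : ℕ → ℕ → (ℕ → ℕ → ℕ) → ℕ → ℕ
Gl n m d i = gPos n m d (fI m i 1) ∸ wr n m d i 1 + 1

Gr : ℕ → ℕ → (ℕ → ℕ → ℕ) → ℕ → ℕ
Gr n m d i = gPos n m d (fI m i m)

Hl : ℕ → ℕ → (ℕ → ℕ → ℕ) → ℕ → ℕ
Hl n m d j = hle n m d (rI n 1 j) ∸ wr n m d 1 j + 1

Hr : ℕ → ℕ → (ℕ → ℕ → ℕ) → ℕ → ℕ
Hr n m d j = hle n m d (rI n n j)

module Submission where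

-- Each element q of R is expanded in S into the run S_q of its w(q) consecutive integers ending at
-- h⊣(q), the total weight of the elements of value at most q.  Since the values of R are distinct,
-- the run of q lies strictly below the run of every element of larger value, so a banded increasing
-- subsequence of R expands to a banded increasing subsequence of S whose length is its weight.
-- Conversely, an increasing subsequence of S visits runs in increasing order of value and takes at
-- most w(q) integers from the run of q, so its length is at most the weight of the elements whose
-- runs it visits, and these form a banded increasing subsequence of R.  The value band
-- [r(1,j⊢), r(|A|,j⊣)] and the integer band [H⊢[j⊢], H⊣[j⊣]] select the same runs, and G⊢[i⊢], G⊣[i⊣]
-- cut S exactly at the runs of R[f(i⊢,1) : f(i⊣,|B|)].  The values of R are distinct because
-- r(i,j) = (j-1)K + i and r~(i,j) = (j-2)K + (K+2-i) with K = 2|A|-1, and these residues separate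
-- both the rows and the two kinds of elements.

open import Defs
open import Data.Nat using (ℕ; zero; suc; _+_; _*_; _∸_; _≤_; _<_; _≰_; _≤?_; _<?_; z≤n; s≤s)
open import Data.Nat.Properties
open import Data.Nat.ListAction using (sum)
open import Data.Nat.ListAction.Properties using (sum-++)
open import Data.List using (List; []; _∷_; _++_; [_]; map; concatMap; length; upTo; applyUpTo; filter; take; drop)
open import Data.List.Properties
  using (filter-accept; filter-reject; length-map; length-upTo; length-++; map-++; concatMap-++; ++-assoc)
open import Data.List.Extrema.Nat using (argmax; argmax-all; f[xs]≤f[argmax])
open import Data.List.Membership.Propositional using (_∈_)
open import Data.List.Membership.Propositional.Properties
  using (∈-map⁺; ∈-map⁻; ∈-++⁺ˡ; ∈-++⁺ʳ; ∈-++⁻; ∈-filter⁺; ∈-filter⁻; ∈-upTo⁺)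
open import Data.List.Relation.Unary.All as All using (All; []; _∷_)
import Data.List.Relation.Unary.All.Properties as All
open import Data.List.Relation.Unary.Any using (Any; here; there)
import Data.List.Relation.Unary.Any.Properties as Any
open import Data.List.Relation.Unary.AllPairs using (AllPairs; []; _∷_)
import Data.List.Relation.Unary.AllPairs.Properties as AllPairs
open import Data.List.Relation.Unary.Linked as Linked using (Linked)
open import Data.List.Relation.Unary.Linked.Properties using (AllPairs⇒Linked; Linked⇒AllPairs)
import Data.List.Relation.Binary.Sublist.Heterogeneous as Sublist
open import Data.List.Relation.Binary.Sublist.Propositional using (_⊆_; []; _∷_; _∷ʳ_; ⊆-refl; ⊆-reflexive; from∈)
open import Data.List.Relation.Binary.Sublist.Propositional.Properties
  using (filter⁺; All-resp-⊆; Any-resp-⊆; length-mono-≤; concat⁺; map⁺; ++⁺ˡ; ++⁺ʳ; []⊆-universal)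
open import Data.Product using (∃; ∃₂; _×_; _,_; proj₁; proj₂)
open import Data.Sum using (_⊎_; inj₁; inj₂)
open import Function using (_∘_)
open import Relation.Binary.Definitions using (tri<; tri≈; tri>)
open import Relation.Binary.PropositionalEquality
  using (_≡_; _≢_; refl; sym; trans; cong; cong₂; subst; module ≡-Reasoning)
open import Relation.Nullary using (Dec; yes; no; contradiction; _×-dec_)

-- Sublists and slices

module _ {A : Set} where
  ⊆-++-split : ∀ (xs : List A) {ys zs} → zs ⊆ xs ++ ys →
    ∃ λ zs₁ → ∃ λ zs₂ → zs ≡ zs₁ ++ zs₂ × zs₁ ⊆ xs × zs₂ ⊆ ys
  ⊆-++-split [] zs⊆ys = [] , _ , refl , [] , zs⊆ys
  ⊆-++-split (x ∷ xs) (.x ∷ʳ zs⊆) with ⊆-++-split xs zs⊆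
  ... | zs₁ , zs₂ , refl , zs₁⊆ , zs₂⊆ = zs₁ , zs₂ , refl , x ∷ʳ zs₁⊆ , zs₂⊆
  ⊆-++-split (x ∷ xs) (refl ∷ zs⊆) with ⊆-++-split xs zs⊆
  ... | zs₁ , zs₂ , refl , zs₁⊆ , zs₂⊆ = x ∷ zs₁ , zs₂ , refl , refl ∷ zs₁⊆ , zs₂⊆

  AllPairs-resp-⊆ : ∀ {_~_ : A → A → Set} {xs ys} → xs ⊆ ys → AllPairs _~_ ys → AllPairs _~_ xs
  AllPairs-resp-⊆ [] [] = []
  AllPairs-resp-⊆ (_ ∷ʳ xs⊆ys) (_ ∷ ys~) = AllPairs-resp-⊆ xs⊆ys ys~
  AllPairs-resp-⊆ (refl ∷ xs⊆ys) (y~ys ∷ ys~) = All-resp-⊆ xs⊆ys y~ys ∷ AllPairs-resp-⊆ xs⊆ys ys~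

  sublists : List A → List (List A)
  sublists [] = [ [] ]
  sublists (x ∷ xs) = map (x ∷_) (sublists xs) ++ sublists xs

  ∈-sublists⁺ : ∀ {ys} xs → ys ⊆ xs → ys ∈ sublists xs
  ∈-sublists⁺ [] [] = here refl
  ∈-sublists⁺ (x ∷ xs) (.x ∷ʳ ys⊆xs) = ∈-++⁺ʳ (map (x ∷_) (sublists xs)) (∈-sublists⁺ xs ys⊆xs)
  ∈-sublists⁺ (x ∷ xs) (refl ∷ ys⊆xs) = ∈-++⁺ˡ (∈-map⁺ (x ∷_) (∈-sublists⁺ xs ys⊆xs))

  ∈-sublists⁻ : ∀ {ys} xs → ys ∈ sublists xs → ys ⊆ xs
  ∈-sublists⁻ [] (here refl) = []
  ∈-sublists⁻ (x ∷ xs) ys∈ with ∈-++⁻ (map (x ∷_) (sublists xs)) ys∈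
  ... | inj₂ ys∈′ = x ∷ʳ ∈-sublists⁻ xs ys∈′
  ... | inj₁ ys∈′ with ∈-map⁻ (x ∷_) ys∈′
  ...   | _ , zs∈ , refl = refl ∷ ∈-sublists⁻ xs zs∈

  drop-length-++ : ∀ (xs : List A) {ys} → drop (length xs) (xs ++ ys) ≡ ys
  drop-length-++ [] = refl
  drop-length-++ (x ∷ xs) = drop-length-++ xs

  take-length-++ : ∀ (xs : List A) {ys} → take (length xs) (xs ++ ys) ≡ xs
  take-length-++ [] = refl
  take-length-++ (x ∷ xs) = cong (x ∷_) (take-length-++ xs)

  take-length+-++ : ∀ (xs : List A) {ys} k → take (length xs + k) (xs ++ ys) ≡ xs ++ take k ys
  take-length+-++ [] k = refl
  take-length+-++ (x ∷ xs) k = cong (x ∷_) (take-length+-++ xs k)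

  slice-++ : ∀ (xs ys zs : List A) → slice (suc (length xs)) (length xs + length ys) (xs ++ ys ++ zs) ≡ ys
  slice-++ xs ys zs = trans
    (cong₂ take (m+n∸m≡n (length xs) (length ys)) (drop-length-++ xs))
    (take-length-++ ys)

concatMap⁺ : ∀ {A B : Set} (f : A → List B) {xs ys} → xs ⊆ ys → concatMap f xs ⊆ concatMap f ys
concatMap⁺ f xs⊆ys = concat⁺ (Sublist.map ⊆-reflexive (map⁺ f xs⊆ys))

countFrom : ℕ → ℕ → List ℕ
countFrom s zero = []
countFrom s (suc k) = s ∷ countFrom (suc s) k

range≡countFrom : ∀ k → range k ≡ countFrom 1 k
range≡countFrom k = go 0 k (λ _ → refl)
  where
  go : ∀ s k {f : ℕ → ℕ} → (∀ x → f x ≡ s + x) → map suc (applyUpTo f k) ≡ countFrom (suc s) k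
  go s zero f≡ = refl
  go s (suc k) f≡ = cong₂ _∷_ (cong suc (trans (f≡ 0) (+-identityʳ s)))
    (go (suc s) k (λ x → trans (f≡ (suc x)) (+-suc s x)))

countFrom-+ : ∀ s k l → countFrom s (k + l) ≡ countFrom s k ++ countFrom (s + k) l
countFrom-+ s zero l = cong (λ s′ → countFrom s′ l) (sym (+-identityʳ s))
countFrom-+ s (suc k) l = cong (s ∷_) (trans (countFrom-+ (suc s) k l)
  (cong (λ s′ → countFrom (suc s) k ++ countFrom s′ l) (sym (+-suc s k))))

-- Weighted lists

_≉_ : Elem → Elem → Set
e ≉ e′ = proj₁ e ≢ proj₁ e′

_≺_ : Elem → Elem → Set
e ≺ e′ = proj₁ e < proj₁ e′

wsum : List Elem → ℕ
wsum xs = sum (map proj₂ xs)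

wsum-mono-⊆ : ∀ {xs ys} → xs ⊆ ys → wsum xs ≤ wsum ys
wsum-mono-⊆ [] = z≤n
wsum-mono-⊆ (y ∷ʳ xs⊆ys) = ≤-trans (wsum-mono-⊆ xs⊆ys) (m≤n+m _ (proj₂ y))
wsum-mono-⊆ (refl ∷ xs⊆ys) = +-monoʳ-≤ _ (wsum-mono-⊆ xs⊆ys)

length-concatMap≡wsum : ∀ {A : Set} (f : Elem → List A) → (∀ e → length (f e) ≡ proj₂ e) →
  ∀ xs → length (concatMap f xs) ≡ wsum xs
length-concatMap≡wsum f length-f [] = refl
length-concatMap≡wsum f length-f (x ∷ xs) =
  trans (length-++ (f x)) (cong₂ _+_ (length-f x) (length-concatMap≡wsum f length-f xs))

wsum-++ : ∀ xs ys → wsum (xs ++ ys) ≡ wsum xs + wsum ys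
wsum-++ xs ys = trans (cong sum (map-++ proj₂ xs ys)) (sum-++ (map proj₂ xs) (map proj₂ ys))

wsum-take-++ : ∀ xs {ys} k → wsum (take (length xs + k) (xs ++ ys)) ≡ wsum xs + wsum (take k ys)
wsum-take-++ xs {ys} k = trans (cong wsum (take-length+-++ xs k)) (wsum-++ xs (take k ys))

g⊢-of-head : ∀ xs e ys → wsum (take (length xs + 1) (xs ++ e ∷ ys)) ∸ proj₂ e + 1 ≡ suc (wsum xs)
g⊢-of-head xs (v , w) ys = begin
  wsum (take (length xs + 1) (xs ++ (v , w) ∷ ys)) ∸ w + 1  ≡⟨ cong (λ g → g ∸ w + 1) (wsum-take-++ xs 1) ⟩
  wsum xs + (w + 0) ∸ w + 1                                 ≡⟨ cong (λ g → wsum xs + g ∸ w + 1) (+-identityʳ w) ⟩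
  wsum xs + w ∸ w + 1                                       ≡⟨ cong (_+ 1) (m+n∸n≡m (wsum xs) w) ⟩
  wsum xs + 1                                               ≡⟨ +-comm (wsum xs) 1 ⟩
  suc (wsum xs)                                             ∎
  where open ≡-Reasoning

g⊣-of-block : ∀ xs ys zs → wsum (take (length xs + length ys) (xs ++ ys ++ zs)) ≡ wsum xs + wsum ys
g⊣-of-block xs ys zs = trans (wsum-take-++ xs (length ys)) (cong (λ ys′ → wsum xs + wsum ys′) (take-length-++ ys))

slice-concatMap : ∀ {A : Set} (f : Elem → List A) → (∀ e → length (f e) ≡ proj₂ e) → ∀ xs ys zs →
  slice (suc (wsum xs)) (wsum xs + wsum ys) (concatMap f (xs ++ ys ++ zs)) ≡ concatMap f ys
slice-concatMap f length-f xs ys zs = begin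
  slice (suc (wsum xs)) (wsum xs + wsum ys) (concatMap f (xs ++ ys ++ zs))
    ≡⟨ cong (slice (suc (wsum xs)) (wsum xs + wsum ys))
         (trans (concatMap-++ f xs (ys ++ zs)) (cong (concatMap f xs ++_) (concatMap-++ f ys zs))) ⟩
  slice (suc (wsum xs)) (wsum xs + wsum ys) (concatMap f xs ++ concatMap f ys ++ concatMap f zs)
    ≡⟨ cong₂ (λ a b → slice (suc a) (a + b) (concatMap f xs ++ concatMap f ys ++ concatMap f zs))
         (sym (length-concatMap≡wsum f length-f xs)) (sym (length-concatMap≡wsum f length-f ys)) ⟩
  slice (suc (length (concatMap f xs))) (length (concatMap f xs) + length (concatMap f ys))
    (concatMap f xs ++ concatMap f ys ++ concatMap f zs)
    ≡⟨ slice-++ (concatMap f xs) (concatMap f ys) (concatMap f zs) ⟩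
  concatMap f ys ∎
  where open ≡-Reasoning

weight-unique : ∀ {R v w w′} → AllPairs _≉_ R → (v , w) ∈ R → (v , w′) ∈ R → w ≡ w′
weight-unique (_ ∷ _) (here refl) (here refl) = refl
weight-unique (e≉R ∷ _) (here refl) (there e′∈R) = contradiction refl (All.lookup e≉R e′∈R)
weight-unique (e≉R ∷ _) (there e∈R) (here refl) = contradiction refl (All.lookup e≉R e∈R)
weight-unique (_ ∷ R≉) (there e∈R) (there e′∈R) = weight-unique R≉ e∈R e′∈R

BandedHIS-exists : ∀ lo hi xs → ∃ (BandedHIS lo hi xs)
BandedHIS-exists lo hi xs = wsum best , (best , best⊆xs , best↑ , best-banded , refl) , maximal
  where
  InBand : Elem → Set
  InBand e = lo ≤ proj₁ e × proj₁ e ≤ hi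
  Candidate : List Elem → Set
  Candidate ys = Linked _≺_ ys × All InBand ys
  candidate? : ∀ ys → Dec (Candidate ys)
  candidate? ys = Linked.linked? (λ e e′ → proj₁ e <? proj₁ e′) ys
    ×-dec All.all? (λ e → (lo ≤? proj₁ e) ×-dec (proj₁ e ≤? hi)) ys
  candidates : List (List Elem)
  candidates = filter candidate? (sublists xs)
  best : List Elem
  best = argmax wsum [] candidates
  best-candidate : best ⊆ xs × Candidate best
  best-candidate = argmax-all wsum {P = λ ys → ys ⊆ xs × Candidate ys} ([]⊆-universal xs , Linked.[] , [])
    (All.tabulate λ ys∈ → let ys∈′ , cand = ∈-filter⁻ candidate? ys∈ in ∈-sublists⁻ xs ys∈′ , cand)
  best⊆xs : best ⊆ xs
  best⊆xs = proj₁ best-candidate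
  best↑ : Linked _≺_ best
  best↑ = proj₁ (proj₂ best-candidate)
  best-banded : All InBand best
  best-banded = proj₂ (proj₂ best-candidate)
  maximal : ∀ k → BandedIncWeight lo hi xs k → k ≤ wsum best
  maximal _ (ys , ys⊆xs , ys↑ , ys-banded , refl) =
    All.lookup (f[xs]≤f[argmax] [] candidates) (∈-filter⁺ candidate? (∈-sublists⁺ xs ys⊆xs) (ys↑ , ys-banded))

-- Runs

h⊣ : List Elem → ℕ → ℕ
h⊣ R q = wsum (filter (λ e → proj₁ e ≤? q) R)

h⊢ : List Elem → Elem → ℕ
h⊢ R (q , w) = h⊣ R q ∸ w + 1

run : List Elem → Elem → List ℕ
run R (q , w) = map (h⊢ R (q , w) +_) (upTo w)

h⊣-mono : ∀ R {q q′} → q ≤ q′ → h⊣ R q ≤ h⊣ R q′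
h⊣-mono R {q} {q′} q≤q′ = wsum-mono-⊆
  (filter⁺ (λ e → proj₁ e ≤? q) (λ e → proj₁ e ≤? q′) (λ { refl v≤q → ≤-trans v≤q q≤q′ }) (⊆-refl {x = R}))

weight≤h⊣ : ∀ {R q w q′} → (q , w) ∈ R → q ≤ q′ → w ≤ h⊣ R q′
weight≤h⊣ {w = w} {q′} e∈R q≤q′ =
  ≤-trans (≤-reflexive (sym (+-identityʳ w))) (wsum-mono-⊆ (from∈ (∈-filter⁺ (λ e → proj₁ e ≤? q′) e∈R q≤q′)))

module _ (R : List Elem) {v w q : ℕ} where
  h⊣-∷-accept : v ≤ q → h⊣ ((v , w) ∷ R) q ≡ w + h⊣ R q
  h⊣-∷-accept v≤q = cong wsum (filter-accept (λ e → proj₁ e ≤? q) {xs = R} v≤q)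

  h⊣-∷-reject : v ≰ q → h⊣ ((v , w) ∷ R) q ≡ h⊣ R q
  h⊣-∷-reject v≰q = cong wsum (filter-reject (λ e → proj₁ e ≤? q) {xs = R} v≰q)

h⊣-gap : ∀ R {v w q q′} → (v , w) ∈ R → q < v → v ≤ q′ → h⊣ R q + w ≤ h⊣ R q′
h⊣-gap ((v , w) ∷ R) {q = q} {q′} (here refl) q<v v≤q′
  rewrite h⊣-∷-reject R {w = w} (<⇒≱ q<v) | h⊣-∷-accept R {w = w} v≤q′ =
    ≤-trans (≤-reflexive (+-comm _ w)) (+-monoʳ-≤ w (h⊣-mono R (≤-trans (<⇒≤ q<v) v≤q′)))
h⊣-gap ((u , x) ∷ R) {w = w} {q} {q′} (there e∈R) q<v v≤q′ with u ≤? q | u ≤? q′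
... | yes u≤q | yes u≤q′ rewrite h⊣-∷-accept R {w = x} u≤q | h⊣-∷-accept R {w = x} u≤q′ =
  ≤-trans (≤-reflexive (+-assoc x _ w)) (+-monoʳ-≤ x (h⊣-gap R e∈R q<v v≤q′))
... | yes u≤q | no u≰q′ = contradiction (≤-trans u≤q (≤-trans (<⇒≤ q<v) v≤q′)) u≰q′
... | no u≰q | yes u≤q′ rewrite h⊣-∷-reject R {w = x} u≰q | h⊣-∷-accept R {w = x} u≤q′ =
  ≤-trans (h⊣-gap R e∈R q<v v≤q′) (m≤n+m _ x)
... | no u≰q | no u≰q′ rewrite h⊣-∷-reject R {w = x} u≰q | h⊣-∷-reject R {w = x} u≰q′ = h⊣-gap R e∈R q<v v≤q′

h⊣<h⊢ : ∀ {R q} e → e ∈ R → q < proj₁ e → h⊣ R q < h⊢ R e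
h⊣<h⊢ (v , w) e∈R q<v =
  ≤-trans (≤-reflexive (+-comm 1 _)) (+-monoˡ-≤ 1 (m+n≤o⇒m≤o∸n _ (h⊣-gap _ e∈R q<v ≤-refl)))

length-run : ∀ R e → length (run R e) ≡ proj₂ e
length-run R (q , w) = trans (length-map _ (upTo w)) (length-upTo w)

run-increasing : ∀ R e → AllPairs _<_ (run R e)
run-increasing R (q , w) = AllPairs.map⁺ (AllPairs.applyUpTo⁺₁ (λ k → k) w (λ i<j _ → +-monoʳ-< _ i<j))

run-bounds : ∀ {R} e → e ∈ R → All (λ y → h⊢ R e ≤ y × y ≤ h⊣ R (proj₁ e)) (run R e)
run-bounds {R} (q , w) e∈R = All.map⁺ (All.applyUpTo⁺₁ _ w λ {k} k<w → m≤m+n _ k , (begin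
  h⊣ R q ∸ w + 1 + k  ≡⟨ +-assoc (h⊣ R q ∸ w) 1 k ⟩
  h⊣ R q ∸ w + suc k  ≤⟨ +-monoʳ-≤ (h⊣ R q ∸ w) k<w ⟩
  h⊣ R q ∸ w + w      ≡⟨ m∸n+n≡m (weight≤h⊣ e∈R ≤-refl) ⟩
  h⊣ R q              ∎))
  where open ≤-Reasoning

run-above : ∀ {R q} e → e ∈ R → q < proj₁ e → All (h⊣ R q <_) (run R e)
run-above e e∈R q<e = All.map (λ bounds → <-≤-trans (h⊣<h⊢ e e∈R q<e) (proj₁ bounds)) (run-bounds e e∈R)

≺-of-run : ∀ {R y} e e′ → e ∈ R → e ≉ e′ → h⊢ R e ≤ y → y < h⊣ R (proj₁ e′) → e ≺ e′
≺-of-run e e′ e∈R e≉e′ e≤y y<e′ with <-cmp (proj₁ e) (proj₁ e′)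
... | tri< e<e′ _ _ = e<e′
... | tri≈ _ e≡e′ _ = contradiction e≡e′ e≉e′
... | tri> _ _ e′<e = contradiction e≤y (<⇒≱ (<-trans y<e′ (h⊣<h⊢ e e∈R e′<e)))

runs-increasing : ∀ {R zs} → All (_∈ R) zs → AllPairs _≺_ zs → AllPairs _<_ (concatMap (run R) zs)
runs-increasing [] [] = []
runs-increasing {R} {e ∷ zs} (e∈R ∷ zs∈R) (e≺zs ∷ zs↑) =
  AllPairs.++⁺ (run-increasing R e) (runs-increasing zs∈R zs↑)
    (All.map (λ bounds → All.map (≤-<-trans (proj₂ bounds)) above) (run-bounds e e∈R))
  where
  above : All (h⊣ R (proj₁ e) <_) (concatMap (run R) zs)
  above = All.concat⁺ (All.map⁺ (All.zipWith (λ (z∈R , e≺z) → run-above _ z∈R e≺z) (zs∈R , e≺zs)))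

module Banded (R : List Elem) (R≉ : AllPairs _≉_ R) (ℓ : Elem) (ℓ∈R : ℓ ∈ R) (hi : ℕ) where

  InBand : Elem → Set
  InBand e = proj₁ ℓ ≤ proj₁ e × proj₁ e ≤ hi

  InBandℕ : ℕ → Set
  InBandℕ y = h⊢ R ℓ ≤ y × y ≤ h⊣ R hi

  h⊢-mono : ∀ {v w} → (v , w) ∈ R → proj₁ ℓ ≤ v → h⊢ R ℓ ≤ h⊢ R (v , w)
  h⊢-mono e∈R ℓ≤e with m≤n⇒m<n∨m≡n ℓ≤e
  ... | inj₁ ℓ<e = ≤-trans (+-monoˡ-≤ 1 (m∸n≤m _ (proj₂ ℓ))) (≤-trans (≤-reflexive (+-comm _ 1)) (h⊣<h⊢ _ e∈R ℓ<e))
  ... | inj₂ refl with weight-unique R≉ ℓ∈R e∈R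
  ...   | refl = ≤-refl

  runs-banded : ∀ {zs} → All (_∈ R) zs → All InBand zs → All InBandℕ (concatMap (run R) zs)
  runs-banded zs∈R zs-banded = All.concat⁺ (All.map⁺ (All.zipWith run-banded (zs∈R , zs-banded)))
    where
    run-banded : ∀ {e} → e ∈ R × InBand e → All InBandℕ (run R e)
    run-banded (e∈R , ℓ≤e , e≤hi) =
      All.map (λ (lower , upper) → ≤-trans (h⊢-mono e∈R ℓ≤e) lower , ≤-trans upper (h⊣-mono R e≤hi))
        (run-bounds _ e∈R)

  band-of-run : ∀ {y} e → e ∈ R → h⊢ R e ≤ y → y ≤ h⊣ R (proj₁ e) → InBandℕ y → InBand e
  band-of-run e e∈R e≤y y≤e (ℓ≤y , y≤hi) = ℓ≤e , e≤hi
    where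
    ℓ≤e : proj₁ ℓ ≤ proj₁ e
    ℓ≤e with proj₁ ℓ ≤? proj₁ e
    ... | yes ℓ≤e = ℓ≤e
    ... | no ℓ≰e = contradiction (≤-trans ℓ≤y y≤e) (<⇒≱ (h⊣<h⊢ ℓ ℓ∈R (≰⇒> ℓ≰e)))
    e≤hi : proj₁ e ≤ hi
    e≤hi with proj₁ e ≤? hi
    ... | yes e≤hi = e≤hi
    ... | no e≰hi = contradiction (≤-trans e≤y y≤hi) (<⇒≱ (h⊣<h⊢ e e∈R (≰⇒> e≰hi)))

  record Cover (X : List Elem) (ys : List ℕ) : Set where
    field
      chosen : List Elem
      chosen⊆X : chosen ⊆ X
      chosen↑ : AllPairs _≺_ chosen
      chosen-banded : All InBand chosen
      -- what forces a newly chosen head to precede every element chosen so far (≺-of-run)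
      chosen-hit : All (λ z → Any (_≤ h⊣ R (proj₁ z)) ys) chosen
      length≤wsum : length ys ≤ wsum chosen

  cover-skip : ∀ {e X ys} → Cover X ys → Cover (e ∷ X) ys
  cover-skip {e} c = record
    { chosen = chosen ; chosen⊆X = e ∷ʳ chosen⊆X ; chosen↑ = chosen↑
    ; chosen-banded = chosen-banded ; chosen-hit = chosen-hit ; length≤wsum = length≤wsum }
    where open Cover c

  cover-take : ∀ {e X y ys₁ ys₂} → e ∈ R → All (_∈ R) X → All (e ≉_) X → y ∷ ys₁ ⊆ run R e →
    All (y <_) ys₂ → InBandℕ y → Cover X ys₂ → Cover (e ∷ X) (y ∷ ys₁ ++ ys₂)
  cover-take {e} {X} {y} {ys₁} {ys₂} e∈R X∈R e≉X ys₁⊆ y<ys₂ y-band c = record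
    { chosen = e ∷ chosen
    ; chosen⊆X = refl ∷ chosen⊆X
    ; chosen↑ = All.tabulate e≺z ∷ chosen↑
    ; chosen-banded = band-of-run e e∈R e≤y y≤e y-band ∷ chosen-banded
    ; chosen-hit = here y≤e ∷ All.map (λ hit → there (Any.++⁺ʳ ys₁ hit)) chosen-hit
    ; length≤wsum = ≤-trans (≤-reflexive (length-++ (y ∷ ys₁)))
        (+-mono-≤ (≤-trans (length-mono-≤ ys₁⊆) (≤-reflexive (length-run R e))) length≤wsum)
    }
    where
    open Cover c
    y-bounds : h⊢ R e ≤ y × y ≤ h⊣ R (proj₁ e)
    y-bounds = All.lookup (run-bounds e e∈R) (Any-resp-⊆ ys₁⊆ (here refl))
    e≤y : h⊢ R e ≤ y
    e≤y = proj₁ y-bounds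
    y≤e : y ≤ h⊣ R (proj₁ e)
    y≤e = proj₂ y-bounds
    e≺z : ∀ {z} → z ∈ chosen → e ≺ z
    e≺z {z} z∈chosen = ≺-of-run e z e∈R (All.lookup (All-resp-⊆ chosen⊆X e≉X) z∈chosen) e≤y
      (All.lookupWith (λ y<y′ y′≤z → <-≤-trans y<y′ y′≤z) y<ys₂ (All.lookup chosen-hit z∈chosen))

  cover : ∀ {X ys} → All (_∈ R) X → AllPairs _≉_ X → ys ⊆ concatMap (run R) X →
    AllPairs _<_ ys → All InBandℕ ys → Cover X ys
  cover [] [] [] [] [] = record
    { chosen = [] ; chosen⊆X = [] ; chosen↑ = [] ; chosen-banded = [] ; chosen-hit = [] ; length≤wsum = z≤n }
  cover {e ∷ X} (e∈R ∷ X∈R) (e≉X ∷ X≉) ys⊆ ys↑ ys-banded with ⊆-++-split (run R e) ys⊆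
  ... | [] , _ , refl , _ , ys₂⊆ = cover-skip (cover X∈R X≉ ys₂⊆ ys↑ ys-banded)
  ... | y ∷ ys₁ , _ , refl , ys₁⊆ , ys₂⊆ with ys↑ | ys-banded
  ...   | y<ys ∷ ys↑′ | y-band ∷ ys-banded′ =
    cover-take e∈R X∈R e≉X ys₁⊆ (All.++⁻ʳ ys₁ y<ys) y-band
      (cover X∈R X≉ ys₂⊆ (AllPairs-resp-⊆ (++⁺ˡ ys₁ ⊆-refl) ys↑′) (All.++⁻ʳ ys₁ ys-banded′))

  HIS≡LIS : ∀ {X} → X ⊆ R →
    ∃ λ k → BandedHIS (proj₁ ℓ) hi X k × BandedLIS (h⊢ R ℓ) (h⊣ R hi) (concatMap (run R) X) k
  HIS≡LIS {X} X⊆R with BandedHIS-exists (proj₁ ℓ) hi X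
  ... | k , his@((zs , zs⊆X , zs↑ , zs-banded , refl) , maximal) = k , his , lis , lis-maximal
    where
    X∈R : All (_∈ R) X
    X∈R = All-resp-⊆ X⊆R (All.tabulate (λ e∈R → e∈R))
    zs∈R : All (_∈ R) zs
    zs∈R = All-resp-⊆ zs⊆X X∈R
    lis : BandedIncLen (h⊢ R ℓ) (h⊣ R hi) (concatMap (run R) X) k
    lis = concatMap (run R) zs , concatMap⁺ (run R) zs⊆X ,
      AllPairs⇒Linked (runs-increasing zs∈R (Linked⇒AllPairs <-trans zs↑)) ,
      runs-banded zs∈R zs-banded , length-concatMap≡wsum (run R) (length-run R) zs
    lis-maximal : ∀ k′ → BandedIncLen (h⊢ R ℓ) (h⊣ R hi) (concatMap (run R) X) k′ → k′ ≤ k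
    lis-maximal _ (ys , ys⊆ , ys↑ , ys-banded , refl) =
      ≤-trans length≤wsum (maximal _ (chosen , chosen⊆X , AllPairs⇒Linked chosen↑ , chosen-banded , refl))
      where open Cover (cover X∈R (AllPairs-resp-⊆ X⊆R R≉) ys⊆ (Linked⇒AllPairs <-trans ys↑) ys-banded)

-- The sequence R_{A,B}

K<[1+a]*K+b : ∀ K a {b} → 1 ≤ b → K < suc a * K + b
K<[1+a]*K+b K a {b} 1≤b = begin-strict
  K              <⟨ m<m+n K 1≤b ⟩
  K + b          ≤⟨ +-monoˡ-≤ b (m≤m+n K (a * K)) ⟩
  suc a * K + b  ∎
  where open ≤-Reasoning

*+-injective : ∀ K a a′ {b b′} → 1 ≤ b → b ≤ K → 1 ≤ b′ → b′ ≤ K →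
  a * K + b ≡ a′ * K + b′ → a ≡ a′ × b ≡ b′
*+-injective K zero zero _ _ _ _ eq = refl , eq
*+-injective K (suc a) zero 1≤b _ _ b′≤K eq = contradiction b′≤K (<⇒≱ (subst (K <_) eq (K<[1+a]*K+b K a 1≤b)))
*+-injective K zero (suc a′) _ b≤K 1≤b′ _ eq = contradiction b≤K (<⇒≱ (subst (K <_) (sym eq) (K<[1+a]*K+b K a′ 1≤b′)))
*+-injective K (suc a) (suc a′) {b} {b′} 1≤b b≤K 1≤b′ b′≤K eq =
  let a≡a′ , b≡b′ = *+-injective K a a′ 1≤b b≤K 1≤b′ b′≤K
        (+-cancelˡ-≡ K _ _ (trans (sym (+-assoc K (a * K) b)) (trans eq (+-assoc K (a′ * K) b′))))
  in cong suc a≡a′ , b≡b′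

[2n∸1]+2≡1+2n : ∀ {n} → 1 ≤ n → 2 * n ∸ 1 + 2 ≡ suc (n + n)
[2n∸1]+2≡1+2n {suc n} _ = begin
  n + suc (n + 0) + 2  ≡⟨ +-comm (n + suc (n + 0)) 2 ⟩
  2 + (n + suc (n + 0)) ≡⟨ cong (λ k → 2 + (n + suc k)) (+-identityʳ n) ⟩
  suc (suc n + suc n)  ∎
  where open ≡-Reasoning

2m∸1≡[m∸1]+m : ∀ {m} → 1 ≤ m → 2 * m ∸ 1 ≡ (m ∸ 1) + m
2m∸1≡[m∸1]+m {suc m} _ = cong (m +_) (cong suc (+-identityʳ m))

n≤2n∸1 : ∀ n → n ≤ 2 * n ∸ 1
n≤2n∸1 zero = z≤n
n≤2n∸1 (suc n) = ≤-trans (s≤s (m≤m+n n (n + 0))) (≤-reflexive (sym (+-suc n (n + 0))))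

k<m∸1⇒2+k≤m : ∀ {k m} → k < m ∸ 1 → 2 + k ≤ m
k<m∸1⇒2+k≤m {m = suc m} k<m = s≤s k<m

m∸k∸2-injective : ∀ {m k k′} → 2 + k ≤ m → 2 + k′ ≤ m → m ∸ k ∸ 2 ≡ m ∸ k′ ∸ 2 → k ≡ k′
m∸k∸2-injective {m} {k} {k′} 2+k≤m 2+k′≤m eq = +-cancelˡ-≡ 2 k k′ (∸-cancelˡ-≡ 2+k≤m 2+k′≤m (begin
  m ∸ (2 + k)  ≡⟨ cong (m ∸_) (+-comm 2 k) ⟩
  m ∸ (k + 2)  ≡⟨ ∸-+-assoc m k 2 ⟨
  m ∸ k ∸ 2    ≡⟨ eq ⟩
  m ∸ k′ ∸ 2   ≡⟨ ∸-+-assoc m k′ 2 ⟩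
  m ∸ (k′ + 2) ≡⟨ cong (m ∸_) (+-comm k′ 2) ⟩
  m ∸ (2 + k′) ∎))
  where open ≡-Reasoning

module Construction (n m : ℕ) (d : ℕ → ℕ → ℕ) where

  R : List Elem
  R = RAB n m d

  row : ℕ → List Elem
  row i = tPart n m d i ++ rPart n m d i

  K : ℕ
  K = 2 * n ∸ 1

  tResidue : ℕ → ℕ
  tResidue i = K + 2 ∸ i

  HasCode : ℕ → ℕ → Elem → Set
  HasCode a b e = proj₁ e ≡ a * K + b

  ≢-by-code : ∀ {a a′ b b′ v v′} → 1 ≤ b × b ≤ K → 1 ≤ b′ × b′ ≤ K →
    v ≡ a * K + b → v′ ≡ a′ * K + b′ → a ≢ a′ ⊎ b ≢ b′ → v ≢ v′
  ≢-by-code {a} {a′} (1≤b , b≤K) (1≤b′ , b′≤K) v≡ v′≡ a≢a′⊎b≢b′ v≡v′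
    with *+-injective K a a′ 1≤b b≤K 1≤b′ b′≤K (trans (sym v≡) (trans v≡v′ v′≡))
  ... | a≡a′ , b≡b′ with a≢a′⊎b≢b′
  ...   | inj₁ a≢a′ = a≢a′ a≡a′
  ...   | inj₂ b≢b′ = b≢b′ b≡b′

  value-rT : ∀ {i x} → i ≤ K + 2 → 2 ≤ x → rT n i x ≡ (x ∸ 2) * K + tResidue i
  value-rT {x = suc zero} _ (s≤s ())
  value-rT {i} {suc (suc x)} i≤K+2 _ = begin
    (K + x * K) + 2 ∸ i  ≡⟨ cong (_∸ i) (trans (cong (_+ 2) (+-comm K (x * K))) (+-assoc (x * K) K 2)) ⟩
    x * K + (K + 2) ∸ i  ≡⟨ +-∸-assoc (x * K) i≤K+2 ⟩
    x * K + tResidue i   ∎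
    where open ≡-Reasoning

  module _ (1≤n : 1 ≤ n) where

    n<tResidue : ∀ {i} → i ≤ n → n < tResidue i
    n<tResidue i≤n =
      m+n≤o⇒m≤o∸n (suc n) (≤-trans (+-monoʳ-≤ (suc n) i≤n) (≤-reflexive (sym ([2n∸1]+2≡1+2n 1≤n))))

    tResidue≤K : ∀ {i} → 2 ≤ i → tResidue i ≤ K
    tResidue≤K 2≤i = ≤-trans (∸-monoʳ-≤ (K + 2) 2≤i) (≤-reflexive (m+n∸n≡m K 2))

    ≤K+2 : ∀ {i} → i ≤ n → i ≤ K + 2
    ≤K+2 i≤n = ≤-trans i≤n (≤-trans (n≤2n∸1 n) (m≤m+n K 2))

    Residue : ℕ → ℕ → Set
    Residue i b = b ≡ i ⊎ (2 ≤ i × b ≡ tResidue i)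

    residue-bounds : ∀ {i b} → 1 ≤ i → i ≤ n → Residue i b → 1 ≤ b × b ≤ K
    residue-bounds 1≤i i≤n (inj₁ refl) = 1≤i , ≤-trans i≤n (n≤2n∸1 n)
    residue-bounds 1≤i i≤n (inj₂ (2≤i , refl)) = ≤-trans (s≤s z≤n) (n<tResidue i≤n) , tResidue≤K 2≤i

    i≢tResidue : ∀ {i j} → i ≤ n → j ≤ n → i ≢ tResidue j
    i≢tResidue i≤n j≤n = <⇒≢ (≤-<-trans i≤n (n<tResidue j≤n))

    residues-≢ : ∀ {i j b b′} → i ≢ j → i ≤ n → j ≤ n → Residue i b → Residue j b′ → b ≢ b′
    residues-≢ i≢j _ _ (inj₁ refl) (inj₁ refl) = i≢j
    residues-≢ _ i≤n j≤n (inj₁ refl) (inj₂ (_ , refl)) = i≢tResidue i≤n j≤n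
    residues-≢ _ i≤n j≤n (inj₂ (_ , refl)) (inj₁ refl) = i≢tResidue j≤n i≤n ∘ sym
    residues-≢ i≢j i≤n j≤n (inj₂ (_ , refl)) (inj₂ (_ , refl)) = i≢j ∘ ∸-cancelˡ-≡ (≤K+2 i≤n) (≤K+2 j≤n)

    CodedInRow : ℕ → Elem → Set
    CodedInRow i e = ∃₂ λ a b → Residue i b × HasCode a b e

    rPart-coded : ∀ i → All (λ e → ∃ λ a → HasCode a i e) (rPart n m d i)
    rPart-coded i = All.map⁺ (All.map⁺ (All.applyUpTo⁺₁ _ m (λ {k} _ → k , refl)))

    tPart-code : ∀ {i k} → i ≤ n → k < m ∸ 1 → HasCode (m ∸ k ∸ 2) (tResidue i) (rT n i (m ∸ k) , dmax n m d)
    tPart-code i≤n k<m∸1 = value-rT (≤K+2 i≤n) (m+n≤o⇒m≤o∸n 2 (k<m∸1⇒2+k≤m k<m∸1))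

    tPart-coded : ∀ i → i ≤ n → All (λ e → 2 ≤ i × ∃ λ a → HasCode a (tResidue i) e) (tPart n m d i)
    tPart-coded zero _ = []
    tPart-coded (suc zero) _ = []
    tPart-coded (suc (suc i)) i≤n =
      All.map⁺ (All.applyUpTo⁺₁ _ (m ∸ 1) λ {k} k<m∸1 → s≤s (s≤s z≤n) , m ∸ k ∸ 2 , tPart-code i≤n k<m∸1)

    row-coded : ∀ i → i ≤ n → All (CodedInRow i) (row i)
    row-coded i i≤n = All.++⁺
      (All.map (λ (2≤i , a , code) → a , tResidue i , inj₂ (2≤i , refl) , code) (tPart-coded i i≤n))
      (All.map (λ (a , code) → a , i , inj₁ refl , code) (rPart-coded i))

    rPart-distinct : ∀ {i} → 1 ≤ i → i ≤ n → AllPairs _≉_ (rPart n m d i)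
    rPart-distinct {i} 1≤i i≤n =
      AllPairs.map⁺ (AllPairs.map⁺ (AllPairs.applyUpTo⁺₁ (λ k → k) m λ k<k′ _ → rI-≢ k<k′))
      where
      i≤K : i ≤ K
      i≤K = ≤-trans i≤n (n≤2n∸1 n)
      rI-≢ : ∀ {k k′} → k < k′ → rI n i (suc k) ≢ rI n i (suc k′)
      rI-≢ {k} {k′} k<k′ = ≢-by-code {a = k} {a′ = k′} (1≤i , i≤K) (1≤i , i≤K) refl refl (inj₁ (<⇒≢ k<k′))

    tPart-distinct : ∀ i → i ≤ n → AllPairs _≉_ (tPart n m d i)
    tPart-distinct zero _ = []
    tPart-distinct (suc zero) _ = []
    tPart-distinct (suc (suc i)) i≤n =
      AllPairs.map⁺ (AllPairs.applyUpTo⁺₁ (λ k → k) (m ∸ 1) λ k<k′ k′<m∸1 → rT-≢ (<-trans k<k′ k′<m∸1) k′<m∸1 k<k′)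
      where
      bounds : 1 ≤ tResidue (suc (suc i)) × tResidue (suc (suc i)) ≤ K
      bounds = residue-bounds (s≤s z≤n) i≤n (inj₂ (s≤s (s≤s z≤n) , refl))
      rT-≢ : ∀ {k k′} → k < m ∸ 1 → k′ < m ∸ 1 → k < k′ → rT n (suc (suc i)) (m ∸ k) ≢ rT n (suc (suc i)) (m ∸ k′)
      rT-≢ {k} {k′} k<m∸1 k′<m∸1 k<k′ =
        ≢-by-code {a = m ∸ k ∸ 2} {a′ = m ∸ k′ ∸ 2} bounds bounds (tPart-code i≤n k<m∸1) (tPart-code i≤n k′<m∸1)
          (inj₁ (<⇒≢ k<k′ ∘ m∸k∸2-injective (k<m∸1⇒2+k≤m k<m∸1) (k<m∸1⇒2+k≤m k′<m∸1)))

    row-distinct : ∀ {i} → 1 ≤ i → i ≤ n → AllPairs _≉_ (row i)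
    row-distinct {i} 1≤i i≤n = AllPairs.++⁺ (tPart-distinct i i≤n) (rPart-distinct 1≤i i≤n)
      (All.map (λ (2≤i , a , code) → All.map (λ (a′ , code′) →
          ≢-by-code {a = a} {a′ = a′}
            (residue-bounds 1≤i i≤n (inj₂ (2≤i , refl))) (residue-bounds 1≤i i≤n (inj₁ refl))
            code code′ (inj₂ (i≢tResidue i≤n i≤n ∘ sym)))
        (rPart-coded i)) (tPart-coded i i≤n))

    rows-≉ : ∀ {i j} → 1 ≤ i → i < j → j ≤ n → All (λ e → All (e ≉_) (row j)) (row i)
    rows-≉ {i} {j} 1≤i i<j j≤n = All.map (λ (a , b , res , code) → All.map (λ (a′ , b′ , res′ , code′) →
        ≢-by-code {a = a} {a′ = a′} (residue-bounds 1≤i i≤n res) (residue-bounds 1≤j j≤n res′) code code′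
          (inj₂ (residues-≢ (<⇒≢ i<j) i≤n j≤n res res′)))
      (row-coded j j≤n)) (row-coded i i≤n)
      where
      i≤n : i ≤ n
      i≤n = ≤-trans (<⇒≤ i<j) j≤n
      1≤j : 1 ≤ j
      1≤j = ≤-trans 1≤i (<⇒≤ i<j)

    RAB-distinct : AllPairs _≉_ R
    RAB-distinct = AllPairs.concat⁺
      (All.map⁺ (All.map⁺ (All.applyUpTo⁺₁ (λ i → i) n (row-distinct (s≤s z≤n)))))
      (AllPairs.map⁺ (AllPairs.map⁺
        (AllPairs.applyUpTo⁺₁ (λ i → i) n λ i<j j<n → rows-≉ (s≤s z≤n) (s≤s i<j) j<n)))

  K′ : ℕ
  K′ = 2 * m ∸ 1

  rows : ℕ → ℕ → List Elem
  rows s k = concatMap row (countFrom s k)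

  rPart-head : ∀ {i} → 1 ≤ m → ∃ λ rest → rPart n m d i ≡ (rI n i 1 , wr n m d i 1) ∷ rest
  rPart-head (s≤s z≤n) = _ , refl

  record Decomposition (il ir : ℕ) : Set where
    field
      before rest after : List Elem
      R≡ : R ≡ before ++ ((rI n il 1 , wr n m d il 1) ∷ rest) ++ after
      fI-first : fI m il 1 ≡ length before + 1
      fI-last : fI m ir m ≡ length before + length ((rI n il 1 , wr n m d il 1) ∷ rest)

  module _ (1≤m : 1 ≤ m) where

    K′≡ : K′ ≡ (m ∸ 1) + m
    K′≡ = 2m∸1≡[m∸1]+m 1≤m

    length-rPart : ∀ i → length (rPart n m d i) ≡ m
    length-rPart i = trans (length-map _ (map suc (upTo m))) (trans (length-map suc (upTo m)) (length-upTo m))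

    length-tPart : ∀ i → length (tPart n m d (suc (suc i))) ≡ m ∸ 1
    length-tPart i = trans (length-map _ (upTo (m ∸ 1))) (length-upTo (m ∸ 1))

    length-row : ∀ i → length (row (suc (suc i))) ≡ K′
    length-row i = trans (length-++ (tPart n m d (suc (suc i))))
      (trans (cong₂ _+_ (length-tPart i) (length-rPart _)) (sym K′≡))

    length-rows : ∀ s k → length (rows (suc (suc s)) k) ≡ k * K′
    length-rows s zero = refl
    length-rows s (suc k) =
      trans (length-++ (row (suc (suc s)))) (cong₂ _+_ (length-row s) (length-rows (suc s) k))

    length-before : ∀ a → length (rows 1 a ++ tPart n m d (suc a)) ≡ a * K′
    length-before zero = refl
    length-before (suc a) = begin
      length ((rPart n m d 1 ++ rows 2 a) ++ tPart n m d (suc (suc a)))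
        ≡⟨ length-++ (rPart n m d 1 ++ rows 2 a) ⟩
      length (rPart n m d 1 ++ rows 2 a) + length (tPart n m d (suc (suc a)))
        ≡⟨ cong₂ _+_ (length-++ (rPart n m d 1)) (length-tPart a) ⟩
      (length (rPart n m d 1) + length (rows 2 a)) + (m ∸ 1)
        ≡⟨ cong₂ (λ x y → (x + y) + (m ∸ 1)) (length-rPart 1) (length-rows 0 a) ⟩
      (m + a * K′) + (m ∸ 1)
        ≡⟨ +-comm (m + a * K′) (m ∸ 1) ⟩
      (m ∸ 1) + (m + a * K′)
        ≡⟨ +-assoc (m ∸ 1) m (a * K′) ⟨
      (m ∸ 1) + m + a * K′
        ≡⟨ cong (_+ a * K′) K′≡ ⟨
      K′ + a * K′ ∎
      where open ≡-Reasoning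

    decompose : ∀ {il ir} → 1 ≤ il → il ≤ ir → ir ≤ n → Decomposition il ir
    decompose {suc a} _ il≤ir ir≤n with m≤n⇒∃[o]m+o≡n il≤ir | m≤n⇒∃[o]m+o≡n ir≤n
    ... | t , refl | u , ir+u≡n with rPart-head {suc a} 1≤m
    ...   | rest₁ , rPart≡ = record
      { before = rows 1 a ++ tPart n m d (suc a)
      ; rest = rest₁ ++ rows (2 + a) t
      ; after = rows (2 + a + t) u
      ; R≡ = R≡
      ; fI-first = cong (_+ 1) (sym (length-before a))
      ; fI-last = sym length≡
      }
      where
      open ≡-Reasoning
      e : Elem
      e = rI n (suc a) 1 , wr n m d (suc a) 1
      countFrom≡ : countFrom 1 n ≡ countFrom 1 a ++ suc a ∷ countFrom (2 + a) t ++ countFrom (2 + a + t) u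
      countFrom≡ = begin
        countFrom 1 n
          ≡⟨ cong (countFrom 1) (trans (sym ir+u≡n) (trans (+-assoc (suc a) t u) (sym (+-suc a (t + u))))) ⟩
        countFrom 1 (a + suc (t + u))
          ≡⟨ countFrom-+ 1 a (suc (t + u)) ⟩
        countFrom 1 a ++ suc a ∷ countFrom (2 + a) (t + u)
          ≡⟨ cong (λ ks → countFrom 1 a ++ suc a ∷ ks) (countFrom-+ (2 + a) t u) ⟩
        countFrom 1 a ++ suc a ∷ countFrom (2 + a) t ++ countFrom (2 + a + t) u ∎
      R≡ : R ≡ (rows 1 a ++ tPart n m d (suc a)) ++ (e ∷ rest₁ ++ rows (2 + a) t) ++ rows (2 + a + t) u
      R≡ = begin
        concatMap row (range n)
          ≡⟨ cong (concatMap row) (trans (range≡countFrom n) countFrom≡) ⟩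
        concatMap row (countFrom 1 a ++ suc a ∷ countFrom (2 + a) t ++ countFrom (2 + a + t) u)
          ≡⟨ concatMap-++ row (countFrom 1 a) _ ⟩
        rows 1 a ++ row (suc a) ++ concatMap row (countFrom (2 + a) t ++ countFrom (2 + a + t) u)
          ≡⟨ cong (λ xs → rows 1 a ++ row (suc a) ++ xs) (concatMap-++ row (countFrom (2 + a) t) _) ⟩
        rows 1 a ++ (tPart n m d (suc a) ++ rPart n m d (suc a)) ++ rows (2 + a) t ++ rows (2 + a + t) u
          ≡⟨ cong (λ xs → rows 1 a ++ (tPart n m d (suc a) ++ xs) ++ rows (2 + a) t ++ rows (2 + a + t) u) rPart≡ ⟩
        rows 1 a ++ (tPart n m d (suc a) ++ e ∷ rest₁) ++ rows (2 + a) t ++ rows (2 + a + t) u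
          ≡⟨ cong (rows 1 a ++_) (++-assoc (tPart n m d (suc a)) (e ∷ rest₁) _) ⟩
        rows 1 a ++ tPart n m d (suc a) ++ e ∷ rest₁ ++ rows (2 + a) t ++ rows (2 + a + t) u
          ≡⟨ ++-assoc (rows 1 a) (tPart n m d (suc a)) _ ⟨
        (rows 1 a ++ tPart n m d (suc a)) ++ e ∷ rest₁ ++ rows (2 + a) t ++ rows (2 + a + t) u
          ≡⟨ cong (λ xs → (rows 1 a ++ tPart n m d (suc a)) ++ e ∷ xs) (++-assoc rest₁ (rows (2 + a) t) _) ⟨
        (rows 1 a ++ tPart n m d (suc a)) ++ (e ∷ rest₁ ++ rows (2 + a) t) ++ rows (2 + a + t) u ∎
      length≡ : length (rows 1 a ++ tPart n m d (suc a)) + length (e ∷ rest₁ ++ rows (2 + a) t) ≡ (a + t) * K′ + m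
      length≡ = begin
        length (rows 1 a ++ tPart n m d (suc a)) + length (e ∷ rest₁ ++ rows (2 + a) t)
          ≡⟨ cong₂ _+_ (length-before a) (length-++ (e ∷ rest₁)) ⟩
        a * K′ + (length (e ∷ rest₁) + length (rows (2 + a) t))
          ≡⟨ cong₂ (λ x y → a * K′ + (x + y)) (trans (cong length (sym rPart≡)) (length-rPart (suc a))) (length-rows a t) ⟩
        a * K′ + (m + t * K′)
          ≡⟨ cong (a * K′ +_) (+-comm m (t * K′)) ⟩
        a * K′ + (t * K′ + m)
          ≡⟨ +-assoc (a * K′) (t * K′) m ⟨
        (a * K′ + t * K′) + m
          ≡⟨ cong (_+ m) (*-distribʳ-+ K′ a t) ⟨
        (a + t) * K′ + m ∎

  lowest∈R : ∀ {j} → 1 ≤ n → 1 ≤ j → j ≤ m → (rI n 1 j , wr n m d 1 j) ∈ R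
  lowest∈R {suc j} (s≤s z≤n) _ j<m = ∈-++⁺ˡ (∈-map⁺ _ (∈-map⁺ suc (∈-upTo⁺ j<m)))

  module _ {il ir} (b : Decomposition il ir) where
    open Decomposition b

    middle : List Elem
    middle = (rI n il 1 , wr n m d il 1) ∷ rest

    middle⊆R : middle ⊆ R
    middle⊆R = subst (middle ⊆_) (sym R≡) (++⁺ˡ before (++⁺ʳ after ⊆-refl))

    slice-RAB : slice (fI m il 1) (fI m ir m) R ≡ middle
    slice-RAB = begin
      slice (fI m il 1) (fI m ir m) R
        ≡⟨ cong₂ (λ p q → slice p q R) (trans fI-first (+-comm (length before) 1)) fI-last ⟩
      slice (suc (length before)) (length before + length middle) R
        ≡⟨ cong (slice (suc (length before)) (length before + length middle)) R≡ ⟩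
      slice (suc (length before)) (length before + length middle) (before ++ middle ++ after)
        ≡⟨ slice-++ before middle after ⟩
      middle ∎
      where open ≡-Reasoning

    slice-SAB : slice (Gl n m d il) (Gr n m d ir) (SAB n m d) ≡ concatMap (run R) middle
    slice-SAB = begin
      slice (Gl n m d il) (Gr n m d ir) (concatMap (run R) R)
        ≡⟨ cong₂ (λ p q → slice p q (concatMap (run R) R)) Gl≡ Gr≡ ⟩
      slice (suc (wsum before)) (wsum before + wsum middle) (concatMap (run R) R)
        ≡⟨ cong (λ xs → slice (suc (wsum before)) (wsum before + wsum middle) (concatMap (run R) xs)) R≡ ⟩
      slice (suc (wsum before)) (wsum before + wsum middle) (concatMap (run R) (before ++ middle ++ after))
        ≡⟨ slice-concatMap (run R) (length-run R) before middle after ⟩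
      concatMap (run R) middle ∎
      where
      open ≡-Reasoning
      Gl≡ : Gl n m d il ≡ suc (wsum before)
      Gl≡ = begin
        wsum (take (fI m il 1) R) ∸ wr n m d il 1 + 1
          ≡⟨ cong (λ p → wsum (take p R) ∸ wr n m d il 1 + 1) fI-first ⟩
        wsum (take (length before + 1) R) ∸ wr n m d il 1 + 1
          ≡⟨ cong (λ xs → wsum (take (length before + 1) xs) ∸ wr n m d il 1 + 1) R≡ ⟩
        wsum (take (length before + 1) (before ++ middle ++ after)) ∸ wr n m d il 1 + 1
          ≡⟨ g⊢-of-head before (rI n il 1 , wr n m d il 1) (rest ++ after) ⟩
        suc (wsum before) ∎
      Gr≡ : Gr n m d ir ≡ wsum before + wsum middle
      Gr≡ = begin
        wsum (take (fI m ir m) R)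
          ≡⟨ cong (λ p → wsum (take p R)) fI-last ⟩
        wsum (take (length before + length middle) R)
          ≡⟨ cong (λ xs → wsum (take (length before + length middle) xs)) R≡ ⟩
        wsum (take (length before + length middle) (before ++ middle ++ after))
          ≡⟨ g⊣-of-block before middle after ⟩
        wsum before + wsum middle ∎

lemma3 : (n m : ℕ) (d : ℕ → ℕ → ℕ) → 1 ≤ n → 1 ≤ m →
    (il ir jl jr : ℕ) → 1 ≤ il → il ≤ ir → ir ≤ n → 1 ≤ jl → jl ≤ jr → jr ≤ m →
    ∃ λ k →
      BandedHIS (rI n 1 jl) (rI n n jr) (slice (fI m il 1) (fI m ir m) (RAB n m d)) k
      × BandedLIS (Hl n m d jl) (Hr n m d jr) (slice (Gl n m d il) (Gr n m d ir) (SAB n m d)) k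
lemma3 n m d 1≤n 1≤m il ir jl jr 1≤il il≤ir ir≤n 1≤jl jl≤jr jr≤m =
  let k , his , lis = HIS≡LIS (middle⊆R b)
  in k , subst (λ xs → BandedHIS _ _ xs k) (sym (slice-RAB b)) his
       , subst (λ ys → BandedLIS _ _ ys k) (sym (slice-SAB b)) lis
  where
  open Construction n m d
  b : Decomposition il ir
  b = decompose 1≤m 1≤il il≤ir ir≤n
  open Banded R (RAB-distinct 1≤n) (rI n 1 jl , wr n m d 1 jl) (lowest∈R 1≤n 1≤jl (≤-trans jl≤jr jr≤m))
    (rI n n jr)
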